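{- Let $k$ be a positive integer. There is no bracelet graph $G$ with an even number of parts and an odd number $n\geq k$ of vertices that is $k$-ordered hamiltonian.
   Context: A graph $G$ is a bracelet graph if its vertex set can be partitioned into nonempty sets $V_1, \ldots, V_m$ with $m\geq 3$ (called the parts) such that two vertices $u\in V_i$ and $v\in V_j$ are adjacent if and only if $i-j\equiv 1$ or $-1 \pmod m$. A simple graph $G$ is $k$-ordered hamiltonian if, for every sequence $v_1, \ldots, v_k$ of $k$ distinct vertices of $G$, there exists a hamiltonian cycle of $G$ containing $v_1, \ldots, v_k$ in this (cyclic) order. -}

module Defs where

open import Data.Nat using (ℕ; zero; suc; _≤_; _<_)
open import Data.Fin using (Fin; toℕ)
open import Data.Integer using (ℤ; +_; _-_; _+_)
open import Data.Integer.Divisibility using (_∣_)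
open import Data.Product using (Σ; ∃; _×_; _,_)
open import Data.Sum using (_⊎_)
open import Relation.Binary.PropositionalEquality using (_≡_)
open import Function.Definitions using (Injective; Surjective)

Graph : ℕ → Set₁
Graph n = Fin n → Fin n → Set

DiffPM1 : (m : ℕ) → Fin m → Fin m → Set
DiffPM1 m i j =
  (+ m ∣ ((+ toℕ i - + toℕ j) - + 1)) ⊎ (+ m ∣ ((+ toℕ i - + toℕ j) + + 1))

IsBraceletWith : ∀ {n} → Graph n → (m : ℕ) → Set
IsBraceletWith {n} G m =
  (3 ≤ m) × Σ (Fin n → Fin m) λ part →
    (∀ (i : Fin m) → ∃ λ v → part v ≡ i) ×
    (∀ u v → (G u v → DiffPM1 m (part u) (part v))
           × (DiffPM1 m (part u) (part v) → G u v))

CycNext : (n : ℕ) → Fin n → Fin n → Set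
CycNext n i j = (toℕ j ≡ suc (toℕ i)) ⊎ ((suc (toℕ i) ≡ n) × (toℕ j ≡ 0))

IsHamCycle : ∀ {n} → Graph n → (Fin n → Fin n) → Set
IsHamCycle {n} G c =
  (3 ≤ n) × Injective _≡_ _≡_ c × (∀ i j → CycNext n i j → G (c i) (c j))

-- The listing c contains v_1,…,v_k in this order (the starting point of a
-- cyclic listing is arbitrary, so cyclic order = increasing positions in
-- some listing of the cycle).
ContainsInOrder : ∀ {n k} → (Fin n → Fin n) → (Fin k → Fin n) → Set
ContainsInOrder {n} {k} c vs =
  Σ (Fin k → Fin n) λ pos →
    (∀ j → c (pos j) ≡ vs j) ×
    (∀ (a b : Fin k) → toℕ a < toℕ b → toℕ (pos a) < toℕ (pos b))

KOrderedHamiltonian : ∀ {n} → (k : ℕ) → Graph n → Set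
KOrderedHamiltonian {n} k G =
  ∀ (vs : Fin k → Fin n) → Injective _≡_ _≡_ vs →
    Σ (Fin n → Fin n) λ c → IsHamCycle G c × ContainsInOrder c vs

-- Since the number m of parts is even, the parity of the part index changes
-- along every edge of a bracelet graph: adjacent parts i, j satisfy
-- i - j ≡ ±1 (mod m), hence mod 2.  A hamiltonian cycle is a closed walk of
-- n steps, each changing the parity, so n is even.  Thus the graph is not
-- even hamiltonian when n is odd, let alone k-ordered hamiltonian.
module Submission where

open import Defs
open import Data.Nat using (ℕ; zero; suc; _≤_; _<_; s≤s⁻¹)
open import Data.Nat.Divisibility using (_∣_; _∣0)
open import Relation.Nullary using (¬_)
open import Data.Nat.Properties using (n<1+n; m<n⇒m<1+n)
open import Data.Fin as Fin using (Fin; toℕ; fromℕ<; inject≤)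
open import Data.Fin.Properties using (toℕ-fromℕ<; inject≤-injective)
open import Data.Integer using (ℤ; +_; -_; _+_; _-_; 1ℤ)
open import Data.Integer.Tactic.RingSolver using (solve-∀)
import Data.Integer.Divisibility as Unsigned
import Data.Integer.Divisibility.Signed as Signed
open import Data.Product using (Σ; _,_; proj₁)
open import Data.Sum using (inj₁; inj₂)
open import Relation.Binary.PropositionalEquality using (_≡_; refl; sym; trans; cong; subst)

IsClosedWalk : ∀ {n} → Graph n → (Fin n → Fin n) → Set
IsClosedWalk {n} G c = ∀ i j → CycNext n i j → G (c i) (c j)

cyclic-unit-steps⇒∣length : ∀ {n} (d : ℤ) (f : Fin n → ℤ) →
  (∀ i j → CycNext n i j → d Signed.∣ (f j - f i) - 1ℤ) → d Signed.∣ + n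
cyclic-unit-steps⇒∣length {zero} d f step = Signed.∣ᵤ⇒∣ (_ ∣0)
cyclic-unit-steps⇒∣length {suc n} d f step =
  subst (d Signed.∣_) (closing (f last) (f Fin.zero) (+ n))
    (Signed.∣m⇒∣-m (Signed.∣m∣n⇒∣m+n (reach n (n<1+n n)) (step last Fin.zero last→zero)))
  where
  last : Fin (suc n)
  last = fromℕ< (n<1+n n)

  last→zero : CycNext (suc n) last Fin.zero
  last→zero = inj₂ (cong suc (toℕ-fromℕ< (n<1+n n)) , refl)

  start : ∀ (x : ℤ) → (x - x) - + 0 ≡ + 0
  start = solve-∀

  telescope : ∀ (a b c x : ℤ) → ((a - b) - 1ℤ) + ((b - c) - x) ≡ (a - c) - (1ℤ + x)
  telescope = solve-∀

  closing : ∀ (a b x : ℤ) → - (((a - b) - x) + ((b - a) - 1ℤ)) ≡ 1ℤ + x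
  closing = solve-∀

  reach : ∀ i (i<1+n : i < suc n) → d Signed.∣ (f (fromℕ< i<1+n) - f Fin.zero) - + i
  reach zero _ = subst (d Signed.∣_) (sym (start (f Fin.zero))) (Signed.∣ᵤ⇒∣ (_ ∣0))
  reach (suc i) i+1<1+n =
    subst (d Signed.∣_) (telescope (f (fromℕ< i+1<1+n)) (f (fromℕ< i<1+n)) (f Fin.zero) (+ i))
      (Signed.∣m∣n⇒∣m+n (step _ _ (inj₁ i→i+1)) (reach i i<1+n))
    where
    i<1+n : i < suc n
    i<1+n = m<n⇒m<1+n (s≤s⁻¹ i+1<1+n)

    i→i+1 : toℕ (fromℕ< i+1<1+n) ≡ suc (toℕ (fromℕ< i<1+n))
    i→i+1 = trans (toℕ-fromℕ< i+1<1+n) (cong suc (sym (toℕ-fromℕ< i<1+n)))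

even-modulus-divides : ∀ {m} x → 2 ∣ m → + m Unsigned.∣ x → + 2 Signed.∣ x
even-modulus-divides x 2∣m m∣x = 
  Signed.∣-trans (Signed.∣ᵤ⇒∣ {+ 2} {+ _} 2∣m) (Signed.∣ᵤ⇒∣ {+ _} {x} m∣x)

DiffPM1⇒odd-gap : ∀ {m} (i j : Fin m) → 2 ∣ m → DiffPM1 m i j →
  + 2 Signed.∣ (+ toℕ j - + toℕ i) - 1ℤ
DiffPM1⇒odd-gap i j 2∣m (inj₁ m∣x-1) =
  subst (+ 2 Signed.∣_) (sym (negate-1 (+ toℕ i) (+ toℕ j)))
    (Signed.∣m∣n⇒∣m-n
      (Signed.∣m⇒∣-m (even-modulus-divides (+ toℕ i - + toℕ j - 1ℤ) 2∣m m∣x-1))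
      Signed.∣-refl)
  where
  negate-1 : ∀ (a b : ℤ) → (b - a) - 1ℤ ≡ - ((a - b) - 1ℤ) - + 2
  negate-1 = solve-∀
DiffPM1⇒odd-gap i j 2∣m (inj₂ m∣x+1) =
  subst (+ 2 Signed.∣_) (sym (negate+1 (+ toℕ i) (+ toℕ j)))
    (Signed.∣m⇒∣-m (even-modulus-divides (+ toℕ i - + toℕ j + 1ℤ) 2∣m m∣x+1))
  where
  negate+1 : ∀ (a b : ℤ) → (b - a) - 1ℤ ≡ - ((a - b) + 1ℤ)
  negate+1 = solve-∀

bracelet-closed-walk-even : ∀ {n} (G : Graph n) {m} → 2 ∣ m → IsBraceletWith G m →
  (c : Fin n → Fin n) → IsClosedWalk G c → 2 ∣ n
bracelet-closed-walk-even G 2∣m (_ , part , _ , adjacency) c walk =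
  Signed.∣⇒∣ᵤ (cyclic-unit-steps⇒∣length (+ 2) (λ i → + toℕ (part (c i)))
    λ i j i→j → DiffPM1⇒odd-gap (part (c i)) (part (c j)) 2∣m
                  (proj₁ (adjacency (c i) (c j)) (walk i j i→j)))

KOrderedHamiltonian⇒hamiltonian : ∀ {n k} (G : Graph n) → k ≤ n →
  KOrderedHamiltonian k G → Σ (Fin n → Fin n) (IsHamCycle G)
KOrderedHamiltonian⇒hamiltonian G k≤n k-ordered =
  let c , hamiltonian , _ =
        k-ordered (λ i → inject≤ i k≤n) (inject≤-injective k≤n k≤n _ _)
  in c , hamiltonian

corollary2p7 : (k : ℕ) → 1 ≤ k →
    (n : ℕ) → ¬ (2 ∣ n) → k ≤ n →
    (G : Graph n) → (m : ℕ) → 2 ∣ m → IsBraceletWith G m →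
    ¬ KOrderedHamiltonian k G
corollary2p7 k _ n n-odd k≤n G m 2∣m bracelet k-ordered =
  let c , (_ , _ , walk) = KOrderedHamiltonian⇒hamiltonian G k≤n k-ordered
  in n-odd (bracelet-closed-walk-even G 2∣m bracelet c walk)
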